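{- Let $r\ge1$, $p\ge2$, $\bm{x}_i=(x_{i1},\ldots,x_{ip})\in\mathbb{C}^p$ for $1\le i\le r$ and $t_1,\ldots,t_{p-1}\in\mathbb{C}\setminus\{0,-1,-2,\ldots\}$. Then $$(\xi_{x_{11},\ldots,x_{r1}}+t_1)\,f^{t_1,\ldots,t_{p-1}}_{\bm{x}_1;\cdots;\bm{x}_r}=f^{t_2,\ldots,t_{p-1}}_{{}^{ - }\bm{x}_1;\cdots;{}^{ - }\bm{x}_r},$$ where ${}^{ - }\bm{x}=(x_2,\ldots,x_p)$ for $\bm{x}=(x_1,\ldots,x_p)$.
   Context: $\mathbb{N}=\{0,1,2,\ldots\}$; $0^0=1$. For complex $z$ and $m\in\mathbb{N}$, $\binom{z}{m}=z(z-1)\cdots(z-m+1)/m!$; multinomial coefficients are $\binom{n}{\nu_1,\ldots,\nu_p}=n!/(\nu_1!\cdots\nu_p!)$. For $p\ge1$, $\bm{x}_i=(x_{i1},\ldots,x_{ip})\in\mathbb{C}^p$ ($1\le i\le r$), $t_1,\ldots,t_{p-1}\in\mathbb{C}\setminus\{0,-1,-2,\ldots\}$ and $n_1,\ldots,n_r\in\mathbb{N}$, define $$c^{t_1,\ldots,t_{p-1}}_{\bm{x}_1;\cdots;\bm{x}_r}(n_1,\ldots,n_r)=\sum\frac{\prod_{i=1}^r\binom{n_i}{\nu_{i1},\ldots,\nu_{ip}}x_{i1}^{\nu_{i1}}\cdots x_{ip}^{\nu_{ip}}}{\prod_{j=1}^{p-1}\binom{n_{1j}+\cdots+n_{rj}+t_j-1}{\nu_{1j}+\cdots+\nu_{rj}}(n_{1j}+\cdots+n_{rj}+t_j)},$$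 summing over all integers $n_{ij}$ with $n_i=n_{i1}\ge n_{i2}\ge\cdots\ge n_{ip}\ge0$ for each $i$, where $\nu_{ij}=n_{ij}-n_{i,j+1}$ for $j<p$ and $\nu_{ip}=n_{ip}$ (for $p=1$ it equals $x_1^{n_1}\cdots x_r^{n_r}$). Its generating function is $f^{t_1,\ldots,t_{p-1}}_{\bm{x}_1;\cdots;\bm{x}_r}=\sum_{n_1,\ldots,n_r\ge0}c^{t_1,\ldots,t_{p-1}}_{\bm{x}_1;\cdots;\bm{x}_r}(n_1,\ldots,n_r)\frac{X_1^{n_1}\cdots X_r^{n_r}}{n_1!\cdots n_r!}\in\mathbb{C}[[X_1,\ldots,X_r]]$. For $y_1,\ldots,y_r\in\mathbb{C}$, $\xi_{y_1,\ldots,y_r}=X_1\partial_{X_1}+\cdots+X_r\partial_{X_r}-y_1X_1-\cdots-y_rX_r$ as an operator on $\mathbb{C}[[X_1,\ldots,X_r]]$. -}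

module Defs where

open import Level using (Level; _⊔_) renaming (suc to lsuc)
open import Data.Nat as ℕ using (ℕ; zero; suc)
open import Data.Nat.Base using (_!)
open import Data.Fin using (Fin; zero; suc; inject₁)
open import Data.List using (List; []; _∷_; [_]; map; concatMap; upTo)
open import Data.Vec.Functional using (Vector; updateAt) renaming (_∷_ to _∷ᵥ_)
open import Function using (_∘_)
open import Relation.Nullary using (¬_)
open import Algebra.Bundles using (CommutativeRing)

-- A field is a commutative
-- ring with 0 ≉ 1 and a *total* inverse operation _⁻¹ which is a genuine
-- inverse on nonzero elements (its value at 0 is unconstrained; it is
-- never used at 0 below under the theorem's hypotheses).

record Field (c ℓ : Level) : Set (lsuc (c ⊔ ℓ)) where
  field
    commutativeRing : CommutativeRing c ℓ
  open CommutativeRing commutativeRing public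
  field
    _⁻¹       : Carrier → Carrier
    ⁻¹-inverse : ∀ x → ¬ (x ≈ 0#) → x * (x ⁻¹) ≈ 1#
    0≉1        : ¬ (0# ≈ 1#)

module FieldOps {c ℓ} (F : Field c ℓ) where
  open Field F using (Carrier; _+_; _*_; _-_; 0#; 1#; _⁻¹)

  ι : ℕ → Carrier
  ι zero    = 0#
  ι (suc n) = 1# + ι n

  _^_ : Carrier → ℕ → Carrier
  z ^ zero  = 1#
  z ^ suc m = z * (z ^ m)

  ΣF : ∀ {n} → (Fin n → Carrier) → Carrier
  ΣF {zero}  f = 0#
  ΣF {suc n} f = f zero + ΣF (f ∘ suc)

  ΠF : ∀ {n} → (Fin n → Carrier) → Carrier
  ΠF {zero}  f = 1#
  ΠF {suc n} f = f zero * ΠF (f ∘ suc)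

  ΣL : List Carrier → Carrier
  ΣL []       = 0#
  ΣL (a ∷ as) = a + ΣL as

  falling : Carrier → ℕ → Carrier
  falling z zero    = 1#
  falling z (suc m) = z * falling (z - 1#) m

  binomial : Carrier → ℕ → Carrier
  binomial z m = falling z m * (ι (m !) ⁻¹)

CharZero : ∀ {c ℓ} → Field c ℓ → Set ℓ
CharZero F = ∀ n → ¬ (ι (suc n) ≈ 0#)
  where open Field F using (_≈_; 0#)
        open FieldOps F

Σℕ : ∀ {n} → (Fin n → ℕ) → ℕ
Σℕ {zero}  f = 0
Σℕ {suc n} f = f zero ℕ.+ Σℕ (f ∘ suc)

Πℕ : ∀ {n} → (Fin n → ℕ) → ℕ
Πℕ {zero}  f = 1
Πℕ {suc n} f = f zero ℕ.* Πℕ (f ∘ suc)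

-- Chains.  With p = suc q, a chain for n is a function
-- m : Fin p → ℕ with n = m 0 ≥ m 1 ≥ ... ≥ m (p-1) ≥ 0.
-- chains q n lists all of them (each exactly once).

chains : (q : ℕ) → ℕ → List (Fin (suc q) → ℕ)
chains zero    n = [ (λ _ → n) ]
chains (suc q) n = concatMap (λ m → map (n ∷ᵥ_) (chains q m)) (upTo (suc n))

-- all r-tuples of chains (n_{ij}) with n_{i1} = n_i
allChains : (r q : ℕ) → (Fin r → ℕ) → List (Fin r → Fin (suc q) → ℕ)
allChains zero    q n = [ (λ ()) ]
allChains (suc r) q n =
  concatMap (λ ch → map (ch ∷ᵥ_) (allChains r q (n ∘ suc))) (chains q (n zero))

-- ν_j = m_j - m_{j+1} for j < p-1 (0-based), ν_{p-1} = m_{p-1}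
nu : ∀ {q} → (Fin (suc q) → ℕ) → Fin (suc q) → ℕ
nu {zero}  m zero    = m zero
nu {suc q} m zero    = m zero ℕ.∸ m (suc zero)
nu {suc q} m (suc j) = nu (m ∘ suc) j

-- The coefficients c and the generating function f.
-- p = suc q;  x : Fin r → Fin p → K (x i j = x_{i,j+1});
-- t : Fin q → K (t j = t_{j+1}).

module Coefficients {c ℓ} (F : Field c ℓ) where
  open Field F public using (Carrier; _≈_; _+_; _*_; _-_; 0#; 1#; _⁻¹)
  open FieldOps F public

  multinomial : ∀ {p} → ℕ → (Fin p → ℕ) → Carrier
  multinomial n ν = ι (n !) * (ι (Πℕ (λ j → ν j !)) ⁻¹)

  term : ∀ {r q} → (Fin r → Fin (suc q) → Carrier) → (Fin q → Carrier)
         → (Fin r → Fin (suc q) → ℕ) → Carrier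
  term {r} {q} x t N = numer * (ΠF denom ⁻¹)
    where
    ν : Fin r → Fin (suc q) → ℕ
    ν i = nu (N i)
    numer : Carrier
    numer = ΠF (λ i → multinomial (N i zero) (ν i) * ΠF (λ j → x i j ^ ν i j))
    denom : Fin q → Carrier
    denom j = binomial (ι S + t j - 1#) V * (ι S + t j)
      where
      S = Σℕ (λ i → N i (inject₁ j))
      V = Σℕ (λ i → ν i (inject₁ j))

  coeff : ∀ {r q} → (Fin r → Fin (suc q) → Carrier) → (Fin q → Carrier)
          → (Fin r → ℕ) → Carrier
  coeff {r} {q} x t n = ΣL (map (term x t) (allChains r q n))

  -- Formal power series in X_1..X_r, given by their (ordinary)
  -- coefficients: g n is the coefficient of X_1^{n_1}⋯X_r^{n_r}.
  PowerSeries : ℕ → Set c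
  PowerSeries r = (Fin r → ℕ) → Carrier

  _≋_ : ∀ {r} → PowerSeries r → PowerSeries r → Set ℓ
  g ≋ h = ∀ n → g n ≈ h n

  genFun : ∀ {r q} → (Fin r → Fin (suc q) → Carrier) → (Fin q → Carrier)
           → PowerSeries r
  genFun x t n = coeff x t n * (ι (Πℕ (λ i → n i !)) ⁻¹)

  XD : ∀ {r} → Fin r → PowerSeries r → PowerSeries r
  XD i g n = ι (n i) * g n

  mulX : ∀ {r} → Fin r → PowerSeries r → PowerSeries r
  mulX i g n with n i
  ... | zero  = 0#
  ... | suc _ = g (updateAt n i ℕ.pred)

  ξ : ∀ {r} → (Fin r → Carrier) → PowerSeries r → PowerSeries r
  ξ y g n = ΣF (λ i → XD i g n) - ΣF (λ i → y i * mulX i g n)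

  ξ+ : ∀ {r} → (Fin r → Carrier) → Carrier → PowerSeries r → PowerSeries r
  ξ+ y s g n = ξ y g n + s * g n

{-# OPTIONS --safe #-}
-- Let G(n) = c(n)/n! (ordCoeff) be the coefficient of X^n in f = f^{t₁,…}_{x₁;…;x_r} and G′ that of
-- f^{t₂,…}_{⁻x₁;…;⁻x_r}.  Splitting off the first column n of a chain leaves a chain starting
-- at some m ≤ n, and the t₁-factor of the denominator depends only on N = |n| and V = |n − m|:
--   G(n) = Σ_{m ≤ n} E(n − m) W(N, V) G′(m),  E(d) = Π_i x_{i1}^{d_i}/d_i! (expProd),
--   W(N, V) = 1 / (binom(N + t₁ − 1, V) (N + t₁)) (weight).
-- The absorption identity V binom(z, V) = z binom(z − 1, V − 1) gives
-- (N + t₁) W(N, V) = V W(N − 1, V − 1) + [V = 0], so (|n| + t₁) G(n) = S(n) + G′(n) with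
-- S(n) (shiftedSum) = Σ_{m ≤ n} |n − m| E(n − m) W(N − 1, V − 1) G′(m).  On the other hand
-- x · x^{d−1}/(d−1)! = d · x^d/d! turns Σ_i x_{i1} G(n − e_i) into the same sum S(n), and the
-- coefficient of X^n in (ξ + t₁) f is (|n| + t₁) G(n) − Σ_i x_{i1} G(n − e_i) = G′(n).
module Submission where

open import Defs
open import Data.Nat using (ℕ; suc; _≤_)
open import Data.Fin using (Fin; zero; suc)
open import Function using (_∘_)
open import Relation.Nullary using (¬_)

open import Data.Nat as ℕ using (zero; z≤n; s≤s; _<_; pred; _∸_)
open import Data.Nat.Base using (_!)
import Data.Nat.Properties as ℕₚ
open import Data.Fin using (inject₁)
open import Data.Fin.Properties using (suc-injective)
open import Data.List using (List; []; _∷_; [_]; map; concatMap; upTo; _++_)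
open import Data.List.Relation.Unary.All as All using (All; []; _∷_)
import Data.List.Relation.Unary.All.Properties as Allₚ
import Data.List.Properties as Listₚ
open import Data.Vec.Functional using (updateAt) renaming (_∷_ to _∷ᵥ_)
open import Data.Vec.Functional.Properties using (updateAt-updates; updateAt-minimal)
open import Relation.Binary.PropositionalEquality as ≡ using (_≡_; _≢_; _≗_; refl; cong; cong₂)

infixl 6 _∸ᵥ_

_∸ᵥ_ : ∀ {r} → (Fin r → ℕ) → (Fin r → ℕ) → Fin r → ℕ
(n ∸ᵥ m) i = n i ∸ m i

pred-∸ : ∀ a b → pred a ∸ b ≡ pred (a ∸ b)
pred-∸ zero    zero    = refl
pred-∸ zero    (suc b) = refl
pred-∸ (suc a) zero    = refl
pred-∸ (suc a) (suc b) = ≡.sym (ℕₚ.pred[m∸n]≡m∸[1+n] a b)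

updateAt-pred-∸ᵥ : ∀ {r} (n m : Fin r → ℕ) i →
                   updateAt n i pred ∸ᵥ m ≗ updateAt (n ∸ᵥ m) i pred
updateAt-pred-∸ᵥ n m zero    zero    = pred-∸ (n zero) (m zero)
updateAt-pred-∸ᵥ n m zero    (suc j) = refl
updateAt-pred-∸ᵥ n m (suc i) zero    = refl
updateAt-pred-∸ᵥ n m (suc i) (suc j) = updateAt-pred-∸ᵥ (n ∘ suc) (m ∘ suc) i j

Σℕ-≗ : ∀ {k} {f g : Fin k → ℕ} → f ≗ g → Σℕ f ≡ Σℕ g
Σℕ-≗ {zero}  f≗g = refl
Σℕ-≗ {suc k} f≗g = cong₂ ℕ._+_ (f≗g zero) (Σℕ-≗ (f≗g ∘ suc))

Πℕ-≗ : ∀ {k} {f g : Fin k → ℕ} → f ≗ g → Πℕ f ≡ Πℕ g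
Πℕ-≗ {zero}  f≗g = refl
Πℕ-≗ {suc k} f≗g = cong₂ ℕ._*_ (f≗g zero) (Πℕ-≗ (f≗g ∘ suc))

Σℕ-mono-≤ : ∀ {k} {f g : Fin k → ℕ} → (∀ i → f i ≤ g i) → Σℕ f ≤ Σℕ g
Σℕ-mono-≤ {zero}  f≤g = z≤n
Σℕ-mono-≤ {suc k} f≤g = ℕₚ.+-mono-≤ (f≤g zero) (Σℕ-mono-≤ (f≤g ∘ suc))

Σℕ≡0⇒≡0 : ∀ {k} (f : Fin k → ℕ) → Σℕ f ≡ 0 → ∀ i → f i ≡ 0
Σℕ≡0⇒≡0 f Σf≡0 zero    = ℕₚ.m+n≡0⇒m≡0 (f zero) Σf≡0
Σℕ≡0⇒≡0 f Σf≡0 (suc i) = Σℕ≡0⇒≡0 (f ∘ suc) (ℕₚ.m+n≡0⇒n≡0 (f zero) Σf≡0) i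

Σℕ-updateAt-pred : ∀ {k} (d : Fin k → ℕ) i {e} → d i ≡ suc e →
                   suc (Σℕ (updateAt d i pred)) ≡ Σℕ d
Σℕ-updateAt-pred d zero    dᵢ≡1+e rewrite dᵢ≡1+e = refl
Σℕ-updateAt-pred d (suc i) dᵢ≡1+e =
  ≡.trans (≡.sym (ℕₚ.+-suc (d zero) _)) (cong (d zero ℕ.+_) (Σℕ-updateAt-pred (d ∘ suc) i dᵢ≡1+e))

chains-head : ∀ q n → All (λ ch → ch zero ≡ n) (chains q n)
chains-head zero    n = refl ∷ []
chains-head (suc q) n =
  Allₚ.concat⁺ (Allₚ.map⁺ (All.universal (λ m → Allₚ.map⁺ (All.universal (λ _ → refl) (chains q m))) (upTo (suc n))))

allChains-head : ∀ r q n → All (λ N → ∀ i → N i zero ≡ n i) (allChains r q n)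
allChains-head zero    q n = (λ ()) ∷ []
allChains-head (suc r) q n = Allₚ.concat⁺ (Allₚ.map⁺ (All.map
  (λ ch₀≡n₀ → Allₚ.map⁺ (All.map (λ N₀≡n → λ { zero → ch₀≡n₀ ; (suc i) → N₀≡n i })
                                  (allChains-head r q (n ∘ suc))))
  (chains-head q (n zero))))

allChains-cong : ∀ r q {n n′} → n ≗ n′ → allChains r q n ≡ allChains r q n′
allChains-cong zero    q n≗n′ = refl
allChains-cong (suc r) q n≗n′ =
  cong₂ (λ a l → concatMap (λ ch → map (ch ∷ᵥ_) l) (chains q a)) (n≗n′ zero) (allChains-cong r q (n≗n′ ∘ suc))

nu-≗ : ∀ {q} {m m′ : Fin (suc q) → ℕ} → m ≗ m′ → nu m ≗ nu m′
nu-≗ {zero}  m≗m′ zero    = m≗m′ zero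
nu-≗ {suc q} m≗m′ zero    = cong₂ _∸_ (m≗m′ zero) (m≗m′ (suc zero))
nu-≗ {suc q} m≗m′ (suc j) = nu-≗ (m≗m′ ∘ suc) j

nu-≤ : ∀ {q} (m : Fin (suc q) → ℕ) (j : Fin q) → nu m (inject₁ j) ≤ m (inject₁ j)
nu-≤ {suc q} m zero    = ℕₚ.m∸n≤m (m zero) (m (suc zero))
nu-≤ {suc q} m (suc j) = nu-≤ (m ∘ suc) j

infixr 5 _∷ᶜ_

_∷ᶜ_ : ∀ {r q} → (Fin r → ℕ) → (Fin r → Fin q → ℕ) → Fin r → Fin (suc q) → ℕ
(n ∷ᶜ N) i = n i ∷ᵥ N i

module FieldProperties {c ℓ} (F : Field c ℓ) where
  open Field F hiding (zero) renaming (refl to ≈-refl; sym to ≈-sym; trans to ≈-trans)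
  open FieldOps F
  open Coefficients F using (mulX; ξ+)
  open import Relation.Binary.Reasoning.Setoid setoid
  open import Algebra.Solver.Ring.NaturalCoefficients.Default commutativeSemiring

  Nonzero : Carrier → Set ℓ
  Nonzero a = ¬ (a ≈ 0#)

  Nonzero-resp : ∀ {a b} → a ≈ b → Nonzero a → Nonzero b
  Nonzero-resp a≈b a≉0 b≈0 = a≉0 (≈-trans a≈b b≈0)

  1-nonzero : Nonzero 1#
  1-nonzero 1≈0 = 0≉1 (≈-sym 1≈0)

  ⁻¹-inverseˡ : ∀ {a} → Nonzero a → a ⁻¹ * a ≈ 1#
  ⁻¹-inverseˡ {a} a≉0 = ≈-trans (*-comm _ _) (⁻¹-inverse a a≉0)

  *-cancelˡ-⁻¹ : ∀ {a} b → Nonzero a → a ⁻¹ * (a * b) ≈ b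
  *-cancelˡ-⁻¹ {a} b a≉0 = begin
    a ⁻¹ * (a * b)  ≈⟨ *-assoc _ _ _ ⟨
    (a ⁻¹ * a) * b  ≈⟨ *-congʳ (⁻¹-inverseˡ a≉0) ⟩
    1# * b          ≈⟨ *-identityˡ b ⟩
    b               ∎

  ⁻¹-unique : ∀ {a b} → Nonzero a → a * b ≈ 1# → b ≈ a ⁻¹
  ⁻¹-unique {a} {b} a≉0 ab≈1 = begin
    b               ≈⟨ *-cancelˡ-⁻¹ b a≉0 ⟨
    a ⁻¹ * (a * b)  ≈⟨ *-congˡ ab≈1 ⟩
    a ⁻¹ * 1#       ≈⟨ *-identityʳ _ ⟩
    a ⁻¹            ∎

  *-nonzero : ∀ {a b} → Nonzero a → Nonzero b → Nonzero (a * b)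
  *-nonzero {a} {b} a≉0 b≉0 ab≈0 = b≉0 (begin
    b               ≈⟨ *-cancelˡ-⁻¹ b a≉0 ⟨
    a ⁻¹ * (a * b)  ≈⟨ *-congˡ ab≈0 ⟩
    a ⁻¹ * 0#       ≈⟨ zeroʳ _ ⟩
    0#              ∎)

  ⁻¹-nonzero : ∀ {a} → Nonzero a → Nonzero (a ⁻¹)
  ⁻¹-nonzero {a} a≉0 a⁻¹≈0 = 0≉1 (begin
    0#        ≈⟨ zeroʳ a ⟨
    a * 0#    ≈⟨ *-congˡ a⁻¹≈0 ⟨
    a * a ⁻¹  ≈⟨ ⁻¹-inverse a a≉0 ⟩
    1#        ∎)

  ⁻¹-cong : ∀ {a b} → Nonzero a → a ≈ b → a ⁻¹ ≈ b ⁻¹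
  ⁻¹-cong a≉0 a≈b =
    ⁻¹-unique (Nonzero-resp a≈b a≉0) (≈-trans (*-congʳ (≈-sym a≈b)) (⁻¹-inverse _ a≉0))

  ⁻¹-distrib-* : ∀ {a b} → Nonzero a → Nonzero b → (a * b) ⁻¹ ≈ a ⁻¹ * b ⁻¹
  ⁻¹-distrib-* {a} {b} a≉0 b≉0 = ≈-sym (⁻¹-unique (*-nonzero a≉0 b≉0) (begin
    (a * b) * (a ⁻¹ * b ⁻¹)  ≈⟨ solve 4 (λ a b c d → (a :* b) :* (c :* d) := (a :* c) :* (b :* d))
                                        ≈-refl a b (a ⁻¹) (b ⁻¹) ⟩
    (a * a ⁻¹) * (b * b ⁻¹)  ≈⟨ *-cong (⁻¹-inverse a a≉0) (⁻¹-inverse b b≉0) ⟩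
    1# * 1#                  ≈⟨ *-identityˡ 1# ⟩
    1#                       ∎))

  1⁻¹≈1 : 1# ⁻¹ ≈ 1#
  1⁻¹≈1 = ≈-sym (⁻¹-unique 1-nonzero (*-identityˡ 1#))

  ι-+ : ∀ m n → ι (m ℕ.+ n) ≈ ι m + ι n
  ι-+ zero    n = ≈-sym (+-identityˡ _)
  ι-+ (suc m) n = ≈-trans (+-congˡ (ι-+ m n)) (≈-sym (+-assoc _ _ _))

  ι-* : ∀ m n → ι (m ℕ.* n) ≈ ι m * ι n
  ι-* zero    n = ≈-sym (zeroˡ _)
  ι-* (suc m) n = begin
    ι (n ℕ.+ m ℕ.* n)  ≈⟨ ι-+ n (m ℕ.* n) ⟩
    ι n + ι (m ℕ.* n)  ≈⟨ +-congˡ (ι-* m n) ⟩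
    ι n + ι m * ι n    ≈⟨ solve 2 (λ a b → a :+ b :* a := (con 1 :+ b) :* a) ≈-refl (ι n) (ι m) ⟩
    (1# + ι m) * ι n   ∎

  ι1≈1 : ι 1 ≈ 1#
  ι1≈1 = +-identityʳ 1#

  ΣF-cong : ∀ {k} {f g : Fin k → Carrier} → (∀ i → f i ≈ g i) → ΣF f ≈ ΣF g
  ΣF-cong {zero}  f≈g = ≈-refl
  ΣF-cong {suc k} f≈g = +-cong (f≈g zero) (ΣF-cong (f≈g ∘ suc))

  ΠF-cong : ∀ {k} {f g : Fin k → Carrier} → (∀ i → f i ≈ g i) → ΠF f ≈ ΠF g
  ΠF-cong {zero}  f≈g = ≈-refl
  ΠF-cong {suc k} f≈g = *-cong (f≈g zero) (ΠF-cong (f≈g ∘ suc))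

  ΣF-distribʳ : ∀ {k} a (f : Fin k → Carrier) → ΣF (λ i → f i * a) ≈ ΣF f * a
  ΣF-distribʳ {zero}  a f = ≈-sym (zeroˡ a)
  ΣF-distribʳ {suc k} a f =
    ≈-trans (+-congˡ (ΣF-distribʳ a (f ∘ suc))) (≈-sym (distribʳ a (f zero) (ΣF (f ∘ suc))))

  ΠF-* : ∀ {k} (f g : Fin k → Carrier) → ΠF (λ i → f i * g i) ≈ ΠF f * ΠF g
  ΠF-* {zero}  f g = ≈-sym (*-identityˡ 1#)
  ΠF-* {suc k} f g = ≈-trans (*-congˡ (ΠF-* (f ∘ suc) (g ∘ suc)))
    (solve 4 (λ a b c d → (a :* b) :* (c :* d) := (a :* c) :* (b :* d)) ≈-refl
           (f zero) (g zero) (ΠF (f ∘ suc)) (ΠF (g ∘ suc)))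

  ΠF-nonzero : ∀ {k} (f : Fin k → Carrier) → (∀ i → Nonzero (f i)) → Nonzero (ΠF f)
  ΠF-nonzero {zero}  f f≉0 = 1-nonzero
  ΠF-nonzero {suc k} f f≉0 = *-nonzero (f≉0 zero) (ΠF-nonzero (f ∘ suc) (f≉0 ∘ suc))

  ΠF-⁻¹ : ∀ {k} (f : Fin k → Carrier) → (∀ i → Nonzero (f i)) → ΠF f ⁻¹ ≈ ΠF (λ i → f i ⁻¹)
  ΠF-⁻¹ {zero}  f f≉0 = 1⁻¹≈1
  ΠF-⁻¹ {suc k} f f≉0 = ≈-trans (⁻¹-distrib-* (f≉0 zero) (ΠF-nonzero (f ∘ suc) (f≉0 ∘ suc)))
                                (*-congˡ (ΠF-⁻¹ (f ∘ suc) (f≉0 ∘ suc)))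

  ΠF-≈1 : ∀ {k} (f : Fin k → Carrier) → (∀ i → f i ≈ 1#) → ΠF f ≈ 1#
  ΠF-≈1 {zero}  f f≈1 = ≈-refl
  ΠF-≈1 {suc k} f f≈1 = ≈-trans (*-cong (f≈1 zero) (ΠF-≈1 (f ∘ suc) (f≈1 ∘ suc))) (*-identityˡ 1#)

  ΠF-≗ : ∀ {k} {f g : Fin k → Carrier} → f ≗ g → ΠF f ≡ ΠF g
  ΠF-≗ {zero}  f≗g = refl
  ΠF-≗ {suc k} f≗g = cong₂ _*_ (f≗g zero) (ΠF-≗ (f≗g ∘ suc))

  ΠF-cong-except : ∀ {k} (i : Fin k) {a b} {f g : Fin k → Carrier} →
                   (∀ j → j ≢ i → f j ≈ g j) → a * f i ≈ b * g i → a * ΠF f ≈ b * ΠF g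
  ΠF-cong-except zero {a} {b} {f} {g} f≈g afᵢ≈bgᵢ = begin
    a * (f zero * ΠF (f ∘ suc))  ≈⟨ *-assoc _ _ _ ⟨
    (a * f zero) * ΠF (f ∘ suc)  ≈⟨ *-cong afᵢ≈bgᵢ (ΠF-cong (λ j → f≈g (suc j) λ ())) ⟩
    (b * g zero) * ΠF (g ∘ suc)  ≈⟨ *-assoc _ _ _ ⟩
    b * (g zero * ΠF (g ∘ suc))  ∎
  ΠF-cong-except (suc i) {a} {b} {f} {g} f≈g afᵢ≈bgᵢ = begin
    a * (f zero * ΠF (f ∘ suc))  ≈⟨ x∙yz≈y∙xz a _ _ ⟩
    f zero * (a * ΠF (f ∘ suc))  ≈⟨ *-cong (f≈g zero λ ())
                                           (ΠF-cong-except i (λ j j≢i → f≈g (suc j) (j≢i ∘ suc-injective)) afᵢ≈bgᵢ) ⟩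
    g zero * (b * ΠF (g ∘ suc))  ≈⟨ x∙yz≈y∙xz _ b _ ⟩
    b * (g zero * ΠF (g ∘ suc))  ∎
    where x∙yz≈y∙xz : ∀ x y z → x * (y * z) ≈ y * (x * z)
          x∙yz≈y∙xz = solve 3 (λ x y z → x :* (y :* z) := y :* (x :* z)) ≈-refl

  ι-Σℕ : ∀ {k} (f : Fin k → ℕ) → ι (Σℕ f) ≈ ΣF (ι ∘ f)
  ι-Σℕ {zero}  f = ≈-refl
  ι-Σℕ {suc k} f = ≈-trans (ι-+ (f zero) (Σℕ (f ∘ suc))) (+-congˡ (ι-Σℕ (f ∘ suc)))

  ι-Πℕ : ∀ {k} (f : Fin k → ℕ) → ι (Πℕ f) ≈ ΠF (ι ∘ f)
  ι-Πℕ {zero}  f = ι1≈1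
  ι-Πℕ {suc k} f = ≈-trans (ι-* (f zero) (Πℕ (f ∘ suc))) (*-congˡ (ι-Πℕ (f ∘ suc)))

  ΣLmap : ∀ {A : Set} → (A → Carrier) → List A → Carrier
  ΣLmap f l = ΣL (map f l)

  ΣLmap-cong : ∀ {A : Set} {f g : A → Carrier} (l : List A) → (∀ a → f a ≈ g a) → ΣLmap f l ≈ ΣLmap g l
  ΣLmap-cong []      f≈g = ≈-refl
  ΣLmap-cong (a ∷ l) f≈g = +-cong (f≈g a) (ΣLmap-cong l f≈g)

  ΣLmap-congAll : ∀ {A : Set} {P : A → Set} {f g : A → Carrier} {l : List A} →
                  All P l → (∀ a → P a → f a ≈ g a) → ΣLmap f l ≈ ΣLmap g l
  ΣLmap-congAll []         f≈g = ≈-refl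
  ΣLmap-congAll (pa ∷ pas) f≈g = +-cong (f≈g _ pa) (ΣLmap-congAll pas f≈g)

  ΣLmap-++ : ∀ {A : Set} (f : A → Carrier) (l₁ l₂ : List A) → ΣLmap f (l₁ ++ l₂) ≈ ΣLmap f l₁ + ΣLmap f l₂
  ΣLmap-++ f []       l₂ = ≈-sym (+-identityˡ _)
  ΣLmap-++ f (a ∷ l₁) l₂ = ≈-trans (+-congˡ (ΣLmap-++ f l₁ l₂)) (≈-sym (+-assoc _ _ _))

  ΣLmap-concatMap : ∀ {A B : Set} (f : B → Carrier) (g : A → List B) (l : List A) →
                    ΣLmap f (concatMap g l) ≈ ΣLmap (ΣLmap f ∘ g) l
  ΣLmap-concatMap f g []      = ≈-refl
  ΣLmap-concatMap f g (a ∷ l) = ≈-trans (ΣLmap-++ f (g a) (concatMap g l)) (+-congˡ (ΣLmap-concatMap f g l))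

  ΣLmap-map : ∀ {A B : Set} (f : B → Carrier) (g : A → B) (l : List A) → ΣLmap f (map g l) ≡ ΣLmap (f ∘ g) l
  ΣLmap-map f g []      = refl
  ΣLmap-map f g (a ∷ l) = cong (f (g a) +_) (ΣLmap-map f g l)

  ΣLmap-concatMap-map : ∀ {A B C : Set} (f : C → Carrier) (h : A → B → C) (L : A → List B) (l : List A) →
                        ΣLmap f (concatMap (λ a → map (h a) (L a)) l) ≈ ΣLmap (λ a → ΣLmap (f ∘ h a) (L a)) l
  ΣLmap-concatMap-map f h L l =
    ≈-trans (ΣLmap-concatMap f _ l) (ΣLmap-cong l (λ a → reflexive (ΣLmap-map f (h a) (L a))))

  ΣLmap-distribˡ : ∀ {A : Set} a (f : A → Carrier) (l : List A) → ΣLmap (λ b → a * f b) l ≈ a * ΣLmap f l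
  ΣLmap-distribˡ a f []      = ≈-sym (zeroʳ a)
  ΣLmap-distribˡ a f (b ∷ l) = ≈-trans (+-congˡ (ΣLmap-distribˡ a f l)) (≈-sym (distribˡ a _ _))

  ΣLmap-+ : ∀ {A : Set} (f g : A → Carrier) (l : List A) → ΣLmap (λ b → f b + g b) l ≈ ΣLmap f l + ΣLmap g l
  ΣLmap-+ f g []      = ≈-sym (+-identityˡ 0#)
  ΣLmap-+ f g (b ∷ l) = ≈-trans (+-congˡ (ΣLmap-+ f g l))
    (solve 4 (λ a b c d → (a :+ b) :+ (c :+ d) := (a :+ c) :+ (b :+ d)) ≈-refl (f b) (g b) (ΣLmap f l) (ΣLmap g l))

  ΣLmap-zero : ∀ {A : Set} (f : A → Carrier) (l : List A) → (∀ a → f a ≈ 0#) → ΣLmap f l ≈ 0#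
  ΣLmap-zero f []      f≈0 = ≈-refl
  ΣLmap-zero f (b ∷ l) f≈0 = ≈-trans (+-cong (f≈0 b) (ΣLmap-zero f l f≈0)) (+-identityˡ 0#)

  ΣLmap-upTo-suc : ∀ k (g : ℕ → Carrier) → ΣLmap g (upTo (suc k)) ≈ ΣLmap g (upTo k) + g k
  ΣLmap-upTo-suc k g = begin
    ΣLmap g (upTo (suc k))            ≡⟨ cong (ΣLmap g) (Listₚ.upTo-∷ʳ k) ⟨
    ΣLmap g (upTo k ++ [ k ])         ≈⟨ ΣLmap-++ g (upTo k) [ k ] ⟩
    ΣLmap g (upTo k) + (g k + 0#)     ≈⟨ +-congˡ (+-identityʳ (g k)) ⟩
    ΣLmap g (upTo k) + g k            ∎

  upTo-< : ∀ k → All (_< k) (upTo k)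
  upTo-< k = Allₚ.applyUpTo⁺₁ (λ i → i) k (λ i<k → i<k)

  ΣBox : ∀ {r} → (Fin r → ℕ) → ((Fin r → ℕ) → Carrier) → Carrier
  ΣBox {zero}  n g = g (λ ())
  ΣBox {suc r} n g = ΣLmap (λ m₀ → ΣBox (n ∘ suc) (g ∘ (m₀ ∷ᵥ_))) (upTo (suc (n zero)))

  ΣBox-congBox : ∀ {r} (n : Fin r → ℕ) {g h : (Fin r → ℕ) → Carrier} →
                 (∀ m → (∀ i → m i ≤ n i) → g m ≈ h m) → ΣBox n g ≈ ΣBox n h
  ΣBox-congBox {zero}  n g≈h = g≈h _ λ ()
  ΣBox-congBox {suc r} n g≈h = ΣLmap-congAll (upTo-< (suc (n zero))) λ m₀ m₀<1+n₀ →
    ΣBox-congBox (n ∘ suc) λ m m≤n → g≈h (m₀ ∷ᵥ m) λ { zero → ℕₚ.≤-pred m₀<1+n₀ ; (suc i) → m≤n i }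

  ΣBox-cong : ∀ {r} (n : Fin r → ℕ) {g h : (Fin r → ℕ) → Carrier} → (∀ m → g m ≈ h m) → ΣBox n g ≈ ΣBox n h
  ΣBox-cong n g≈h = ΣBox-congBox n (λ m _ → g≈h m)

  ΣBox-+ : ∀ {r} (n : Fin r → ℕ) (g h : (Fin r → ℕ) → Carrier) → ΣBox n (λ m → g m + h m) ≈ ΣBox n g + ΣBox n h
  ΣBox-+ {zero}  n g h = ≈-refl
  ΣBox-+ {suc r} n g h = ≈-trans (ΣLmap-cong (upTo (suc (n zero))) (λ m₀ → ΣBox-+ (n ∘ suc) _ _))
                                 (ΣLmap-+ _ _ (upTo (suc (n zero))))

  ΣBox-distribˡ : ∀ {r} (n : Fin r → ℕ) a (g : (Fin r → ℕ) → Carrier) → ΣBox n (λ m → a * g m) ≈ a * ΣBox n g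
  ΣBox-distribˡ {zero}  n a g = ≈-refl
  ΣBox-distribˡ {suc r} n a g = ≈-trans (ΣLmap-cong (upTo (suc (n zero))) (λ m₀ → ΣBox-distribˡ (n ∘ suc) a _))
                                        (ΣLmap-distribˡ a _ (upTo (suc (n zero))))

  ΣBox-zero : ∀ {r} (n : Fin r → ℕ) (g : (Fin r → ℕ) → Carrier) → (∀ m → g m ≈ 0#) → ΣBox n g ≈ 0#
  ΣBox-zero {zero}  n g g≈0 = g≈0 _
  ΣBox-zero {suc r} n g g≈0 = ΣLmap-zero _ (upTo (suc (n zero))) (λ m₀ → ΣBox-zero (n ∘ suc) _ (g≈0 ∘ (m₀ ∷ᵥ_)))

  ΣBox-ΣLmap : ∀ {A : Set} {r} (n : Fin r → ℕ) (g : A → (Fin r → ℕ) → Carrier) (l : List A) →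
               ΣLmap (λ a → ΣBox n (g a)) l ≈ ΣBox n (λ m → ΣLmap (λ a → g a m) l)
  ΣBox-ΣLmap n g []      = ≈-sym (ΣBox-zero n _ (λ m → ≈-refl))
  ΣBox-ΣLmap n g (a ∷ l) = ≈-trans (+-congˡ (ΣBox-ΣLmap n g l)) (≈-sym (ΣBox-+ n _ _))

  ΣBox-ΣF : ∀ {k r} (n : Fin r → ℕ) (g : Fin k → (Fin r → ℕ) → Carrier) →
            ΣF (λ i → ΣBox n (g i)) ≈ ΣBox n (λ m → ΣF (λ i → g i m))
  ΣBox-ΣF {zero}  n g = ≈-sym (ΣBox-zero n _ (λ m → ≈-refl))
  ΣBox-ΣF {suc k} n g = ≈-trans (+-congˡ (ΣBox-ΣF n (g ∘ suc))) (≈-sym (ΣBox-+ n _ _))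

  ΣBox-shrink : ∀ {r} (n : Fin r → ℕ) i {k} (g : (Fin r → ℕ) → Carrier) → n i ≡ suc k →
                (∀ m → m i ≡ n i → g m ≈ 0#) → ΣBox n g ≈ ΣBox (updateAt n i pred) g
  ΣBox-shrink {suc r} n zero {k} g n₀≡1+k g≈0 rewrite n₀≡1+k = begin
    ΣLmap G (upTo (suc (suc k)))     ≈⟨ ΣLmap-upTo-suc (suc k) G ⟩
    ΣLmap G (upTo (suc k)) + G (suc k)  ≈⟨ +-congˡ (ΣBox-zero (n ∘ suc) _ (λ m → g≈0 (suc k ∷ᵥ m) refl)) ⟩
    ΣLmap G (upTo (suc k)) + 0#      ≈⟨ +-identityʳ _ ⟩
    ΣLmap G (upTo (suc k))           ∎
    where G : ℕ → Carrier
          G m₀ = ΣBox (n ∘ suc) (g ∘ (m₀ ∷ᵥ_))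
  ΣBox-shrink {suc r} n (suc i) g nᵢ≡1+k g≈0 = ΣLmap-cong (upTo (suc (n zero))) λ m₀ →
    ΣBox-shrink (n ∘ suc) i (g ∘ (m₀ ∷ᵥ_)) nᵢ≡1+k (λ m → g≈0 (m₀ ∷ᵥ m))

  δ₀ : ℕ → Carrier
  δ₀ zero    = 1#
  δ₀ (suc _) = 0#

  δ₀-+ : ∀ a b → δ₀ (a ℕ.+ b) ≈ δ₀ a * δ₀ b
  δ₀-+ zero    b = ≈-sym (*-identityˡ _)
  δ₀-+ (suc a) b = ≈-sym (zeroˡ _)

  δ₀-∸ : ∀ {m n} → m < n → δ₀ (n ∸ m) ≈ 0#
  δ₀-∸ {zero}  {suc n} _   = ≈-refl
  δ₀-∸ {suc m} {suc n} m<n = δ₀-∸ (ℕₚ.≤-pred m<n)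

  δ₀-absorb : ∀ V {a} → (V ≡ 0 → a ≈ 1#) → δ₀ V * a ≈ δ₀ V
  δ₀-absorb zero    a≈1 = ≈-trans (*-identityˡ _) (a≈1 refl)
  δ₀-absorb (suc V) _   = zeroˡ _

  ΣBox-δ₀ : ∀ {r} (n : Fin r → ℕ) (h : (Fin r → ℕ) → Carrier) → (∀ {m m′} → m ≗ m′ → h m ≈ h m′) →
            ΣBox n (λ m → δ₀ (Σℕ (n ∸ᵥ m)) * h m) ≈ h n
  ΣBox-δ₀ {zero}  n h h-resp = ≈-trans (*-identityˡ _) (h-resp λ ())
  ΣBox-δ₀ {suc r} n h h-resp = begin
    ΣLmap (λ m₀ → ΣBox (n ∘ suc) (λ m → δ₀ (n₀ ∸ m₀ ℕ.+ Σℕ ((n ∘ suc) ∸ᵥ m)) * h (m₀ ∷ᵥ m)))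
          (upTo (suc n₀))
      ≈⟨ ΣLmap-cong (upTo (suc n₀)) first-row ⟩
    ΣLmap H (upTo (suc n₀))
      ≈⟨ ΣLmap-upTo-suc n₀ H ⟩
    ΣLmap H (upTo n₀) + δ₀ (n₀ ∸ n₀) * h (n₀ ∷ᵥ n ∘ suc)
      ≈⟨ +-cong (≈-trans (ΣLmap-congAll (upTo-< n₀) (λ m₀ m₀<n₀ → ≈-trans (*-congʳ (δ₀-∸ m₀<n₀)) (zeroˡ _)))
                         (ΣLmap-zero (λ _ → 0#) (upTo n₀) (λ _ → ≈-refl)))
                (*-congʳ (reflexive (cong δ₀ (ℕₚ.n∸n≡0 n₀)))) ⟩
    0# + 1# * h (n₀ ∷ᵥ n ∘ suc)
      ≈⟨ ≈-trans (+-identityˡ _) (*-identityˡ _) ⟩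
    h (n₀ ∷ᵥ n ∘ suc)
      ≈⟨ h-resp (λ { zero → refl ; (suc i) → refl }) ⟩
    h n ∎
    where
    n₀ = n zero
    H : ℕ → Carrier
    H m₀ = δ₀ (n₀ ∸ m₀) * h (m₀ ∷ᵥ n ∘ suc)
    first-row : ∀ m₀ → ΣBox (n ∘ suc) (λ m → δ₀ (n₀ ∸ m₀ ℕ.+ Σℕ ((n ∘ suc) ∸ᵥ m)) * h (m₀ ∷ᵥ m))
                       ≈ H m₀
    first-row m₀ = begin
      ΣBox (n ∘ suc) (λ m → δ₀ (n₀ ∸ m₀ ℕ.+ Σℕ ((n ∘ suc) ∸ᵥ m)) * h (m₀ ∷ᵥ m))
        ≈⟨ ΣBox-cong (n ∘ suc) (λ m → ≈-trans (*-congʳ (δ₀-+ (n₀ ∸ m₀) _)) (*-assoc _ _ _)) ⟩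
      ΣBox (n ∘ suc) (λ m → δ₀ (n₀ ∸ m₀) * (δ₀ (Σℕ ((n ∘ suc) ∸ᵥ m)) * h (m₀ ∷ᵥ m)))
        ≈⟨ ΣBox-distribˡ (n ∘ suc) _ _ ⟩
      δ₀ (n₀ ∸ m₀) * ΣBox (n ∘ suc) (λ m → δ₀ (Σℕ ((n ∘ suc) ∸ᵥ m)) * h (m₀ ∷ᵥ m))
        ≈⟨ *-congˡ (ΣBox-δ₀ (n ∘ suc) (h ∘ (m₀ ∷ᵥ_))
                             (λ m≗m′ → h-resp λ { zero → refl ; (suc i) → m≗m′ i })) ⟩
      H m₀ ∎

  whenSuc : ℕ → Carrier → Carrier
  whenSuc zero    _ = 0#
  whenSuc (suc _) a = a

  whenSuc-cong : ∀ k {a b} → a ≈ b → whenSuc k a ≈ whenSuc k b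
  whenSuc-cong zero    _   = ≈-refl
  whenSuc-cong (suc k) a≈b = a≈b

  cross-multiply : ∀ {a b u v} → Nonzero u → Nonzero v → a * u ≈ b * v → b * u ⁻¹ ≈ a * v ⁻¹
  cross-multiply {a} {b} {u} {v} u≉0 v≉0 au≈bv = begin
    b * u ⁻¹                  ≈⟨ *-identityʳ _ ⟨
    b * u ⁻¹ * 1#             ≈⟨ *-congˡ (⁻¹-inverse v v≉0) ⟨
    b * u ⁻¹ * (v * v ⁻¹)     ≈⟨ solve 4 (λ b u′ v v′ → b :* u′ :* (v :* v′) := (b :* v) :* u′ :* v′)
                                          ≈-refl b (u ⁻¹) v (v ⁻¹) ⟩
    (b * v) * u ⁻¹ * v ⁻¹     ≈⟨ *-congʳ (*-congʳ au≈bv) ⟨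
    (a * u) * u ⁻¹ * v ⁻¹     ≈⟨ *-congʳ (solve 3 (λ a u u′ → (a :* u) :* u′ := a :* (u :* u′)) ≈-refl a u (u ⁻¹)) ⟩
    a * (u * u ⁻¹) * v ⁻¹     ≈⟨ *-congʳ (≈-trans (*-congˡ (⁻¹-inverse u u≉0)) (*-identityʳ a)) ⟩
    a * v ⁻¹                  ∎

  mulX-whenSuc : ∀ {r} i (g : (Fin r → ℕ) → Carrier) n → mulX i g n ≡ whenSuc (n i) (g (updateAt n i pred))
  mulX-whenSuc i g n with n i
  ... | zero  = refl
  ... | suc _ = refl

  mulX-cong : ∀ {r} i {g h : (Fin r → ℕ) → Carrier} → (∀ n → g n ≈ h n) → ∀ n → mulX i g n ≈ mulX i h n
  mulX-cong i {g} {h} g≈h n = begin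
    mulX i g n                              ≡⟨ mulX-whenSuc i g n ⟩
    whenSuc (n i) (g (updateAt n i pred))   ≈⟨ whenSuc-cong (n i) (g≈h _) ⟩
    whenSuc (n i) (h (updateAt n i pred))   ≡⟨ mulX-whenSuc i h n ⟨
    mulX i h n                              ∎

  ξ+-cong : ∀ {r} (y : Fin r → Carrier) s {g h : (Fin r → ℕ) → Carrier} →
            (∀ n → g n ≈ h n) → ∀ n → ξ+ y s g n ≈ ξ+ y s h n
  ξ+-cong {r} y s g≈h n =
    +-cong (+-cong (ΣF-cong {r} λ i → *-congˡ {ι (n i)} (g≈h n))
                   (-‿cong (ΣF-cong {r} λ i → *-congˡ {y i} (mulX-cong i g≈h n))))
           (*-congˡ (g≈h n))

  ξ+-expand : ∀ {r} (y : Fin r → Carrier) s (g : (Fin r → ℕ) → Carrier) n →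
              ξ+ y s g n ≈ (ι (Σℕ n) + s) * g n - ΣF (λ i → y i * mulX i g n)
  ξ+-expand y s g n = begin
    (ΣF (λ i → ι (n i) * g n) - S) + s * g n  ≈⟨ +-congʳ (+-congʳ (ΣF-distribʳ (g n) (ι ∘ n))) ⟩
    (ΣF (ι ∘ n) * g n - S) + s * g n          ≈⟨ +-congʳ (+-congʳ (*-congʳ (ι-Σℕ n))) ⟨
    (ι (Σℕ n) * g n - S) + s * g n            ≈⟨ solve 4 (λ a g u s → (a :* g :+ u) :+ s :* g := (a :+ s) :* g :+ u)
                                                          ≈-refl (ι (Σℕ n)) (g n) (- S) s ⟩
    (ι (Σℕ n) + s) * g n - S                  ∎
    where S = ΣF (λ i → y i * mulX i g n)

module ChainCoefficients {c ℓ} (F : Field c ℓ) (char0 : CharZero F) where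
  open Field F hiding (zero) renaming (refl to ≈-refl; sym to ≈-sym; trans to ≈-trans)
  open FieldOps F
  open Coefficients F using (multinomial; term; genFun; mulX)
  open FieldProperties F
  open import Relation.Binary.Reasoning.Setoid setoid
  open import Algebra.Solver.Ring.NaturalCoefficients.Default commutativeSemiring
  open import Algebra.Properties.AbelianGroup +-abelianGroup using (xyx⁻¹≈y)

  !-nonzero : ∀ n → Nonzero (ι (n !))
  !-nonzero zero    = char0 0
  !-nonzero (suc n) = Nonzero-resp (≈-sym (ι-* (suc n) (n !))) (*-nonzero (char0 n) (!-nonzero n))

  ι[1+n]!⁻¹ : ∀ n → ι (suc n !) ⁻¹ ≈ ι (suc n) ⁻¹ * ι (n !) ⁻¹
  ι[1+n]!⁻¹ n = ≈-trans (⁻¹-cong (!-nonzero (suc n)) (ι-* (suc n) (n !))) (⁻¹-distrib-* (char0 n) (!-nonzero n))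

  ι0!⁻¹ : ι (0 !) ⁻¹ ≈ 1#
  ι0!⁻¹ = ≈-trans (⁻¹-cong (char0 0) ι1≈1) 1⁻¹≈1

  expCoeff : Carrier → ℕ → Carrier
  expCoeff a k = a ^ k * ι (k !) ⁻¹

  expCoeff-zero : ∀ a → expCoeff a 0 ≈ 1#
  expCoeff-zero a = ≈-trans (*-identityˡ _) ι0!⁻¹

  expCoeff-suc : ∀ a d → ι (suc d) * expCoeff a (suc d) ≈ a * expCoeff a d
  expCoeff-suc a d = begin
    ι (suc d) * (a * a ^ d * ι (suc d !) ⁻¹)                   ≈⟨ *-congˡ (*-congˡ (ι[1+n]!⁻¹ d)) ⟩
    ι (suc d) * (a * a ^ d * (ι (suc d) ⁻¹ * ι (d !) ⁻¹))
      ≈⟨ solve 5 (λ k a b k′ f → k :* ((a :* b) :* (k′ :* f)) := (k :* k′) :* (a :* (b :* f)))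
                 ≈-refl (ι (suc d)) a (a ^ d) (ι (suc d) ⁻¹) (ι (d !) ⁻¹) ⟩
    (ι (suc d) * ι (suc d) ⁻¹) * (a * expCoeff a d)           ≈⟨ *-congʳ (⁻¹-inverse _ (char0 d)) ⟩
    1# * (a * expCoeff a d)                                    ≈⟨ *-identityˡ _ ⟩
    a * expCoeff a d                                           ∎

  multinomial-*-pow : ∀ {p} n (ν : Fin p → ℕ) (y : Fin p → Carrier) →
                      multinomial n ν * ΠF (λ j → y j ^ ν j) ≈ ι (n !) * ΠF (λ j → expCoeff (y j) (ν j))
  multinomial-*-pow n ν y = begin
    ι (n !) * ι (Πℕ (λ j → ν j !)) ⁻¹ * ΠF (λ j → y j ^ ν j)
      ≈⟨ *-congʳ (*-congˡ (≈-trans (⁻¹-cong Πν!≉0 (ι-Πℕ (λ j → ν j !)))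
                                   (ΠF-⁻¹ (λ j → ι (ν j !)) (!-nonzero ∘ ν)))) ⟩
    ι (n !) * ΠF (λ j → ι (ν j !) ⁻¹) * ΠF (λ j → y j ^ ν j)
      ≈⟨ solve 3 (λ a b c → (a :* b) :* c := a :* (c :* b)) ≈-refl _ _ _ ⟩
    ι (n !) * (ΠF (λ j → y j ^ ν j) * ΠF (λ j → ι (ν j !) ⁻¹))
      ≈⟨ *-congˡ (ΠF-* (λ j → y j ^ ν j) (λ j → ι (ν j !) ⁻¹)) ⟨
    ι (n !) * ΠF (λ j → expCoeff (y j) (ν j)) ∎
    where
    Πν!≉0 : Nonzero (ι (Πℕ (λ j → ν j !)))
    Πν!≉0 = Nonzero-resp (≈-sym (ι-Πℕ (λ j → ν j !))) (ΠF-nonzero _ (!-nonzero ∘ ν))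

  expProd : ∀ {r} → (Fin r → Carrier) → (Fin r → ℕ) → Carrier
  expProd x d = ΠF (λ i → expCoeff (x i) (d i))

  expProd-≗ : ∀ {r} (x : Fin r → Carrier) {d e : Fin r → ℕ} → d ≗ e → expProd x d ≡ expProd x e
  expProd-≗ x d≗e = ΠF-≗ (λ i → cong (expCoeff (x i)) (d≗e i))

  expProd-zero : ∀ {r} (x : Fin r → Carrier) (d : Fin r → ℕ) → Σℕ d ≡ 0 → expProd x d ≈ 1#
  expProd-zero x d Σd≡0 = ΠF-≈1 _ λ i →
    ≈-trans (reflexive (cong (expCoeff (x i)) (Σℕ≡0⇒≡0 d Σd≡0 i))) (expCoeff-zero (x i))

  expProd-updateAt-pred : ∀ {r} (x : Fin r → Carrier) (d : Fin r → ℕ) i {e} → d i ≡ suc e →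
                          x i * expProd x (updateAt d i pred) ≈ ι (d i) * expProd x d
  expProd-updateAt-pred x d i {e} dᵢ≡1+e = ΠF-cong-except i
    (λ j j≢i → reflexive (cong (expCoeff (x j)) (updateAt-minimal j i d j≢i)))
    (begin
      x i * expCoeff (x i) (updateAt d i pred i)  ≡⟨ cong (λ k → x i * expCoeff (x i) k)
                                                          (≡.trans (updateAt-updates i d) (cong pred dᵢ≡1+e)) ⟩
      x i * expCoeff (x i) e                      ≈⟨ expCoeff-suc (x i) e ⟨
      ι (suc e) * expCoeff (x i) (suc e)          ≡⟨ cong (λ k → ι k * expCoeff (x i) k) dᵢ≡1+e ⟨
      ι (d i) * expCoeff (x i) (d i)              ∎)

  expConv : ∀ {r} → (Fin r → Carrier) → (ℕ → (Fin r → ℕ) → Carrier) → (Fin r → ℕ) → Carrier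
  expConv x Φ n = ΣBox n (λ m → expProd x (n ∸ᵥ m) * Φ (Σℕ (n ∸ᵥ m)) m)

  expConv-shift-term : ∀ {r} (x : Fin r → Carrier) (Φ : ℕ → (Fin r → ℕ) → Carrier) (n m : Fin r → ℕ) i {k} →
    n i ≡ suc k → m i ≤ k →
    x i * (expProd x (updateAt n i pred ∸ᵥ m) * Φ (Σℕ (updateAt n i pred ∸ᵥ m)) m)
      ≈ ι (suc k ∸ m i) * (expProd x (n ∸ᵥ m) * Φ (pred (Σℕ (n ∸ᵥ m))) m)
  expConv-shift-term x Φ n m i {k} nᵢ≡1+k mᵢ≤k = begin
    x i * (expProd x (updateAt n i pred ∸ᵥ m) * Φ (Σℕ (updateAt n i pred ∸ᵥ m)) m)
      ≡⟨ cong₂ (λ E v → x i * (E * Φ v m)) (expProd-≗ x (updateAt-pred-∸ᵥ n m i)) Σd⁻≡ ⟩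
    x i * (expProd x (updateAt d i pred) * Φ (pred (Σℕ d)) m)
      ≈⟨ *-assoc _ _ _ ⟨
    x i * expProd x (updateAt d i pred) * Φ (pred (Σℕ d)) m
      ≈⟨ *-congʳ (expProd-updateAt-pred x d i dᵢ≡1+e) ⟩
    ι (d i) * expProd x d * Φ (pred (Σℕ d)) m
      ≈⟨ *-assoc _ _ _ ⟩
    ι (n i ∸ m i) * (expProd x d * Φ (pred (Σℕ d)) m)
      ≡⟨ cong (λ a → ι (a ∸ m i) * (expProd x d * Φ (pred (Σℕ d)) m)) nᵢ≡1+k ⟩
    ι (suc k ∸ m i) * (expProd x d * Φ (pred (Σℕ d)) m) ∎
    where
    d = n ∸ᵥ m
    dᵢ≡1+e : d i ≡ suc (k ∸ m i)
    dᵢ≡1+e = ≡.trans (cong (_∸ m i) nᵢ≡1+k) (ℕₚ.+-∸-assoc 1 mᵢ≤k)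
    Σd⁻≡ : Σℕ (updateAt n i pred ∸ᵥ m) ≡ pred (Σℕ d)
    Σd⁻≡ = ≡.trans (Σℕ-≗ (updateAt-pred-∸ᵥ n m i)) (cong pred (Σℕ-updateAt-pred d i dᵢ≡1+e))

  -- The terms with m i = n i gained by enlarging the box n − e_i to n carry the factor ι 0.
  expConv-shift : ∀ {r} (x : Fin r → Carrier) (Φ : ℕ → (Fin r → ℕ) → Carrier) (n : Fin r → ℕ) i →
    x i * whenSuc (n i) (expConv x Φ (updateAt n i pred))
      ≈ ΣBox n (λ m → ι (n i ∸ m i) * (expProd x (n ∸ᵥ m) * Φ (pred (Σℕ (n ∸ᵥ m))) m))
  expConv-shift {r} x Φ n i = shift (n i) refl
    where
    Z : (Fin r → ℕ) → Carrier
    Z m = expProd x (n ∸ᵥ m) * Φ (pred (Σℕ (n ∸ᵥ m))) m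
    n⁻ = updateAt n i pred
    shift : ∀ k → n i ≡ k → x i * whenSuc k (expConv x Φ n⁻) ≈ ΣBox n (λ m → ι (k ∸ m i) * Z m)
    shift zero    _ = ≈-trans (zeroʳ (x i))
      (≈-sym (ΣBox-zero n _ λ m → ≈-trans (*-congʳ (reflexive (cong ι (ℕₚ.0∸n≡0 (m i))))) (zeroˡ _)))
    shift (suc k) nᵢ≡1+k = begin
      x i * ΣBox n⁻ (λ m → expProd x (n⁻ ∸ᵥ m) * Φ (Σℕ (n⁻ ∸ᵥ m)) m)
        ≈⟨ ΣBox-distribˡ n⁻ (x i) _ ⟨
      ΣBox n⁻ (λ m → x i * (expProd x (n⁻ ∸ᵥ m) * Φ (Σℕ (n⁻ ∸ᵥ m)) m))
        ≈⟨ ΣBox-congBox n⁻ (λ m m≤n⁻ → expConv-shift-term x Φ n m i nᵢ≡1+k (mᵢ≤k m m≤n⁻)) ⟩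
      ΣBox n⁻ (λ m → ι (suc k ∸ m i) * Z m)
        ≈⟨ ΣBox-shrink n i _ nᵢ≡1+k (λ m mᵢ≡nᵢ → ≈-trans (*-congʳ (reflexive (cong ι (topRow mᵢ≡nᵢ)))) (zeroˡ _)) ⟨
      ΣBox n (λ m → ι (suc k ∸ m i) * Z m) ∎
      where
      mᵢ≤k : ∀ m → (∀ j → m j ≤ n⁻ j) → m i ≤ k
      mᵢ≤k m m≤n⁻ = ≡.subst (m i ≤_) (≡.trans (updateAt-updates i n) (cong pred nᵢ≡1+k)) (m≤n⁻ i)
      topRow : ∀ {a} → a ≡ n i → suc k ∸ a ≡ 0
      topRow a≡nᵢ = ≡.trans (cong (suc k ∸_) (≡.trans a≡nᵢ nᵢ≡1+k)) (ℕₚ.n∸n≡0 (suc k))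

  falling-cong : ∀ k {z z′} → z ≈ z′ → falling z k ≈ falling z′ k
  falling-cong zero    _    = ≈-refl
  falling-cong (suc k) z≈z′ = *-cong z≈z′ (falling-cong k (+-congʳ z≈z′))

  binomial-suc : ∀ z V → ι (suc V) * binomial z (suc V) ≈ z * binomial (z - 1#) V
  binomial-suc z V = begin
    ι (suc V) * (z * falling (z - 1#) V * ι (suc V !) ⁻¹)                ≈⟨ *-congˡ (*-congˡ (ι[1+n]!⁻¹ V)) ⟩
    ι (suc V) * (z * falling (z - 1#) V * (ι (suc V) ⁻¹ * ι (V !) ⁻¹))
      ≈⟨ solve 5 (λ k z f k′ g → k :* ((z :* f) :* (k′ :* g)) := (k :* k′) :* (z :* (f :* g)))
                 ≈-refl (ι (suc V)) z (falling (z - 1#) V) (ι (suc V) ⁻¹) (ι (V !) ⁻¹) ⟩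
    (ι (suc V) * ι (suc V) ⁻¹) * (z * binomial (z - 1#) V)               ≈⟨ *-congʳ (⁻¹-inverse _ (char0 V)) ⟩
    1# * (z * binomial (z - 1#) V)                                       ≈⟨ *-identityˡ _ ⟩
    z * binomial (z - 1#) V                                              ∎

  ι[1+S]+s-1≈ι[S]+s : ∀ S s → ι (suc S) + s - 1# ≈ ι S + s
  ι[1+S]+s-1≈ι[S]+s S s = ≈-trans (+-congʳ (+-assoc 1# (ι S) s)) (xyx⁻¹≈y 1# (ι S + s))

  denominator : Carrier → ℕ → ℕ → Carrier
  denominator s S V = binomial (ι S + s - 1#) V * (ι S + s)

  weight : Carrier → ℕ → ℕ → Carrier
  weight s S V = denominator s S V ⁻¹

  denominator-suc : ∀ s S V → ι (suc V) * denominator s (suc S) (suc V) ≈ (ι (suc S) + s) * denominator s S V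
  denominator-suc s S V = begin
    ι (suc V) * (binomial (ι (suc S) + s - 1#) (suc V) * (ι (suc S) + s))  ≈⟨ *-assoc _ _ _ ⟨
    ι (suc V) * binomial (ι (suc S) + s - 1#) (suc V) * (ι (suc S) + s)    ≈⟨ *-congʳ (binomial-suc _ V) ⟩
    (ι (suc S) + s - 1#) * binomial (ι (suc S) + s - 1# - 1#) V * (ι (suc S) + s)
      ≈⟨ *-congʳ (*-cong ι[1+S]+s-1 (*-congʳ (falling-cong V (+-congʳ ι[1+S]+s-1)))) ⟩
    (ι S + s) * binomial (ι S + s - 1#) V * (ι (suc S) + s)
      ≈⟨ solve 3 (λ a B b → (a :* B) :* b := b :* (B :* a)) ≈-refl _ _ _ ⟩
    (ι (suc S) + s) * denominator s S V                                   ∎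
    where ι[1+S]+s-1 = ι[1+S]+s-1≈ι[S]+s S s

  module _ {s : Carrier} (s+k≉0 : ∀ k → Nonzero (s + ι k)) where
    ι+s≉0 : ∀ S → Nonzero (ι S + s)
    ι+s≉0 S = Nonzero-resp (+-comm s (ι S)) (s+k≉0 S)

    falling-nonzero : ∀ {z} S V → z ≈ ι S + s - 1# → V ≤ S → Nonzero (falling z V)
    falling-nonzero S       zero    _   _         = 1-nonzero
    falling-nonzero (suc S) (suc V) z≈ (s≤s V≤S) =
      *-nonzero (Nonzero-resp (≈-sym z≈ι+s) (ι+s≉0 S)) (falling-nonzero S V (+-congʳ z≈ι+s) V≤S)
      where z≈ι+s = ≈-trans z≈ (ι[1+S]+s-1≈ι[S]+s S s)

    denominator-nonzero : ∀ S V → V ≤ S → Nonzero (denominator s S V)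
    denominator-nonzero S V V≤S =
      *-nonzero (*-nonzero (falling-nonzero S V ≈-refl V≤S) (⁻¹-nonzero (!-nonzero V))) (ι+s≉0 S)

    weight-recurrence : ∀ N V → V ≤ N → (ι N + s) * weight s N V ≈ ι V * weight s (pred N) (pred V) + δ₀ V
    weight-recurrence N zero _ = begin
      (ι N + s) * denominator s N 0 ⁻¹  ≈⟨ *-congˡ (⁻¹-cong (denominator-nonzero N 0 z≤n) D≈ι+s) ⟩
      (ι N + s) * (ι N + s) ⁻¹          ≈⟨ ⁻¹-inverse _ (ι+s≉0 N) ⟩
      1#                                ≈⟨ ≈-trans (+-congʳ (zeroˡ _)) (+-identityˡ 1#) ⟨
      0# * weight s (pred N) 0 + 1#     ∎
      where
      D≈ι+s : denominator s N 0 ≈ ι N + s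
      D≈ι+s = ≈-trans (*-congʳ (≈-trans (*-identityˡ _) ι0!⁻¹)) (*-identityˡ _)
    weight-recurrence (suc N) (suc V) (s≤s V≤N) =
      ≈-trans (cross-multiply (denominator-nonzero (suc N) (suc V) (s≤s V≤N)) (denominator-nonzero N V V≤N)
                              (denominator-suc s N V))
              (≈-sym (+-identityʳ _))
    *-weight-recurrence : ∀ N V a b → V ≤ N → (V ≡ 0 → a ≈ 1#) →
      (ι N + s) * (a * (weight s N V * b)) ≈ ι V * (a * (weight s (pred N) (pred V) * b)) + δ₀ V * b
    *-weight-recurrence N V a b V≤N V≡0⇒a≈1 = begin
      (ι N + s) * (a * (weight s N V * b))
        ≈⟨ solve 4 (λ c a w b → c :* (a :* (w :* b)) := a :* (c :* w) :* b) ≈-refl _ a _ b ⟩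
      a * ((ι N + s) * weight s N V) * b
        ≈⟨ *-congʳ (*-congˡ (weight-recurrence N V V≤N)) ⟩
      a * (ι V * weight s (pred N) (pred V) + δ₀ V) * b
        ≈⟨ solve 5 (λ a k w d b → a :* (k :* w :+ d) :* b := k :* (a :* (w :* b)) :+ (d :* a) :* b)
                   ≈-refl a (ι V) _ (δ₀ V) b ⟩
      ι V * (a * (weight s (pred N) (pred V) * b)) + δ₀ V * a * b
        ≈⟨ +-congˡ (*-congʳ (δ₀-absorb V V≡0⇒a≈1)) ⟩
      ι V * (a * (weight s (pred N) (pred V) * b)) + δ₀ V * b ∎

  ΣLmap-allChains-suc : ∀ r q (n : Fin r → ℕ) (f : (Fin r → Fin (suc (suc q)) → ℕ) → Carrier) →
    (∀ {N N′} → (∀ i → N i ≗ N′ i) → f N ≈ f N′) →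
    ΣLmap f (allChains r (suc q) n) ≈ ΣBox n (λ m → ΣLmap (f ∘ (n ∷ᶜ_)) (allChains r q m))
  ΣLmap-allChains-suc zero    q n f f-resp = +-congʳ (f-resp λ ())
  ΣLmap-allChains-suc (suc r) q n f f-resp = ≈-trans firstColumns (≈-sym remainingColumns)
    where
    n₀ = n zero
    n′ = n ∘ suc
    inner : ℕ → (Fin r → ℕ) → Carrier
    inner m₀ m′ = ΣLmap (λ c → ΣLmap (λ R → f ((n₀ ∷ᵥ c) ∷ᵥ (n′ ∷ᶜ R))) (allChains r q m′)) (chains q m₀)
    firstColumns : ΣLmap f (allChains (suc r) (suc q) n) ≈ ΣLmap (λ m₀ → ΣBox n′ (inner m₀)) (upTo (suc n₀))
    firstColumns = begin
      ΣLmap f (concatMap (λ ch → map (ch ∷ᵥ_) (allChains r (suc q) n′)) (chains (suc q) n₀))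
        ≈⟨ ΣLmap-concatMap-map f _∷ᵥ_ (λ _ → allChains r (suc q) n′) (chains (suc q) n₀) ⟩
      ΣLmap (λ ch → ΣLmap (f ∘ (ch ∷ᵥ_)) (allChains r (suc q) n′)) (chains (suc q) n₀)
        ≈⟨ ΣLmap-concatMap-map _ (λ _ → n₀ ∷ᵥ_) (chains q) (upTo (suc n₀)) ⟩
      ΣLmap (λ m₀ → ΣLmap (λ c → ΣLmap (f ∘ ((n₀ ∷ᵥ c) ∷ᵥ_)) (allChains r (suc q) n′)) (chains q m₀)) (upTo (suc n₀))
        ≈⟨ ΣLmap-cong (upTo (suc n₀)) (λ m₀ → ≈-trans
             (ΣLmap-cong (chains q m₀) λ c → ΣLmap-allChains-suc r q n′ (f ∘ ((n₀ ∷ᵥ c) ∷ᵥ_))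
               (λ N≗N′ → f-resp λ { zero j → refl ; (suc i) → N≗N′ i }))
             (ΣBox-ΣLmap n′ _ (chains q m₀))) ⟩
      ΣLmap (λ m₀ → ΣBox n′ (inner m₀)) (upTo (suc n₀)) ∎
    remainingColumns : ΣBox n (λ m → ΣLmap (f ∘ (n ∷ᶜ_)) (allChains (suc r) q m))
                       ≈ ΣLmap (λ m₀ → ΣBox n′ (inner m₀)) (upTo (suc n₀))
    remainingColumns = ΣLmap-cong (upTo (suc n₀)) λ m₀ → ΣBox-cong n′ λ m′ →
      ≈-trans (ΣLmap-concatMap-map (f ∘ (n ∷ᶜ_)) _∷ᵥ_ (λ _ → allChains r q m′) (chains q m₀))
              (ΣLmap-cong (chains q m₀) λ c → ΣLmap-cong (allChains r q m′) λ R →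
                f-resp λ { zero j → refl ; (suc i) j → refl })

  chainDenominator : ∀ {r q} → (Fin q → Carrier) → (Fin r → Fin (suc q) → ℕ) → Fin q → Carrier
  chainDenominator t N j = denominator (t j) (Σℕ (λ i → N i (inject₁ j))) (Σℕ (λ i → nu (N i) (inject₁ j)))

  chainTerm : ∀ {r q} → (Fin r → Fin (suc q) → Carrier) → (Fin q → Carrier) → (Fin r → Fin (suc q) → ℕ) → Carrier
  chainTerm x t N = ΠF (λ i → expProd (x i) (nu (N i))) * ΠF (chainDenominator t N) ⁻¹

  ordCoeff : ∀ {r q} → (Fin r → Fin (suc q) → Carrier) → (Fin q → Carrier) → (Fin r → ℕ) → Carrier
  ordCoeff {r} {q} x t n = ΣLmap (chainTerm x t) (allChains r q n)

  ordCoeff-≗ : ∀ {r q} (x : Fin r → Fin (suc q) → Carrier) (t : Fin q → Carrier) {n n′} →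
               n ≗ n′ → ordCoeff x t n ≡ ordCoeff x t n′
  ordCoeff-≗ x t n≗n′ = cong (ΣLmap (chainTerm x t)) (allChains-cong _ _ n≗n′)

  chainDenominator-nonzero : ∀ {r q} {t : Fin q → Carrier} → (∀ j k → Nonzero (t j + ι k)) →
                             ∀ (N : Fin r → Fin (suc q) → ℕ) j → Nonzero (chainDenominator t N j)
  chainDenominator-nonzero t+k≉0 N j = denominator-nonzero (t+k≉0 j) _ _ (Σℕ-mono-≤ λ i → nu-≤ (N i) j)

  chainTerm-≗ : ∀ {r q} (x : Fin r → Fin (suc q) → Carrier) (t : Fin q → Carrier) {N N′} →
                (∀ i → N i ≗ N′ i) → chainTerm x t N ≡ chainTerm x t N′
  chainTerm-≗ x t N≗N′ = cong₂ (λ A B → A * B ⁻¹)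
    (ΠF-≗ λ i → expProd-≗ (x i) (nu-≗ (N≗N′ i)))
    (ΠF-≗ λ j → cong₂ (denominator (t j)) (Σℕ-≗ λ i → N≗N′ i (inject₁ j))
                                           (Σℕ-≗ λ i → nu-≗ (N≗N′ i) (inject₁ j)))

  term≈chainTerm : ∀ {r q} (x : Fin r → Fin (suc q) → Carrier) (t : Fin q → Carrier) N →
                   term x t N ≈ ι (Πℕ (λ i → N i zero !)) * chainTerm x t N
  term≈chainTerm x t N = begin
    ΠF (λ i → multinomial (N i zero) (nu (N i)) * ΠF (λ j → x i j ^ nu (N i) j)) * D⁻¹
      ≈⟨ *-congʳ (ΠF-cong λ i → multinomial-*-pow (N i zero) (nu (N i)) (x i)) ⟩
    ΠF (λ i → ι (N i zero !) * expProd (x i) (nu (N i))) * D⁻¹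
      ≈⟨ *-congʳ (ΠF-* (λ i → ι (N i zero !)) (λ i → expProd (x i) (nu (N i)))) ⟩
    ΠF (λ i → ι (N i zero !)) * ΠF (λ i → expProd (x i) (nu (N i))) * D⁻¹
      ≈⟨ *-congʳ (*-congʳ (ι-Πℕ (λ i → N i zero !))) ⟨
    ι (Πℕ (λ i → N i zero !)) * ΠF (λ i → expProd (x i) (nu (N i))) * D⁻¹
      ≈⟨ *-assoc _ _ _ ⟩
    ι (Πℕ (λ i → N i zero !)) * chainTerm x t N ∎
    where D⁻¹ = ΠF (chainDenominator t N) ⁻¹

  genFun≈ordCoeff : ∀ {r q} (x : Fin r → Fin (suc q) → Carrier) (t : Fin q → Carrier) n → genFun x t n ≈ ordCoeff x t n
  genFun≈ordCoeff {r} {q} x t n = begin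
    ΣLmap (term x t) (allChains r q n) * n! ⁻¹
      ≈⟨ *-congʳ (ΣLmap-congAll (allChains-head r q n) λ N N₀≡n →
           ≈-trans (term≈chainTerm x t N) (*-congʳ (reflexive (cong ι (Πℕ-≗ λ i → cong _! (N₀≡n i)))))) ⟩
    ΣLmap (λ N → n! * chainTerm x t N) (allChains r q n) * n! ⁻¹
      ≈⟨ *-congʳ (ΣLmap-distribˡ n! _ (allChains r q n)) ⟩
    n! * ordCoeff x t n * n! ⁻¹
      ≈⟨ solve 3 (λ a b c → (a :* b) :* c := (a :* c) :* b) ≈-refl _ _ _ ⟩
    n! * n! ⁻¹ * ordCoeff x t n
      ≈⟨ *-congʳ (⁻¹-inverse n! n!≉0) ⟩
    1# * ordCoeff x t n
      ≈⟨ *-identityˡ _ ⟩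
    ordCoeff x t n ∎
    where
    n! = ι (Πℕ (λ i → n i !))
    n!≉0 : Nonzero n!
    n!≉0 = Nonzero-resp (≈-sym (ι-Πℕ (λ i → n i !))) (ΠF-nonzero _ (!-nonzero ∘ n))

  module ColumnRecursion {r q} (x : Fin r → Fin (suc (suc q)) → Carrier) (t : Fin (suc q) → Carrier)
                         (t+k≉0 : ∀ j k → Nonzero (t j + ι k)) where
    x₀ : Fin r → Carrier
    x₀ i = x i zero

    x′ : Fin r → Fin (suc q) → Carrier
    x′ i = x i ∘ suc

    t₀ : Carrier
    t₀ = t zero

    t′ : Fin q → Carrier
    t′ = t ∘ suc

    chainTerm-∷ᶜ : ∀ n N → chainTerm x t (n ∷ᶜ N)
      ≈ expProd x₀ (n ∸ᵥ (λ i → N i zero)) * (weight t₀ (Σℕ n) (Σℕ (n ∸ᵥ (λ i → N i zero))) * chainTerm x′ t′ N)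
    chainTerm-∷ᶜ n N = begin
      ΠF (λ i → expCoeff (x₀ i) (n i ∸ N i zero) * expProd (x′ i) (nu (N i))) * (d₀ * D′) ⁻¹
        ≈⟨ *-cong (ΠF-* (λ i → expCoeff (x₀ i) (n i ∸ N i zero)) (λ i → expProd (x′ i) (nu (N i))))
                  (⁻¹-distrib-* (chainDenominator-nonzero t+k≉0 (n ∷ᶜ N) zero)
                                (ΠF-nonzero _ (chainDenominator-nonzero (t+k≉0 ∘ suc) N))) ⟩
      (E * P′) * (d₀ ⁻¹ * D′ ⁻¹)
        ≈⟨ solve 4 (λ a b c d → (a :* b) :* (c :* d) := a :* (c :* (b :* d))) ≈-refl E P′ (d₀ ⁻¹) (D′ ⁻¹) ⟩
      E * (d₀ ⁻¹ * (P′ * D′ ⁻¹)) ∎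
      where
      E = expProd x₀ (n ∸ᵥ (λ i → N i zero))
      P′ = ΠF (λ i → expProd (x′ i) (nu (N i)))
      d₀ = chainDenominator t (n ∷ᶜ N) zero
      D′ = ΠF (chainDenominator t′ N)

    ordCoeff-peel : ∀ n → ordCoeff x t n ≈ expConv x₀ (λ v m → weight t₀ (Σℕ n) v * ordCoeff x′ t′ m) n
    ordCoeff-peel n = ≈-trans
      (ΣLmap-allChains-suc r q n (chainTerm x t) (λ N≗N′ → reflexive (chainTerm-≗ x t N≗N′)))
      (ΣBox-cong n peelAt)
      where
      d≗ : ∀ {m} {N : Fin r → Fin (suc q) → ℕ} → (∀ i → N i zero ≡ m i) → n ∸ᵥ (λ i → N i zero) ≗ n ∸ᵥ m
      d≗ N₀≡m i = cong (n i ∸_) (N₀≡m i)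
      peelAt : ∀ m → ΣLmap (λ N → chainTerm x t (n ∷ᶜ N)) (allChains r q m)
                     ≈ expProd x₀ (n ∸ᵥ m) * (weight t₀ (Σℕ n) (Σℕ (n ∸ᵥ m)) * ordCoeff x′ t′ m)
      peelAt m = begin
        ΣLmap (λ N → chainTerm x t (n ∷ᶜ N)) (allChains r q m)
          ≈⟨ ΣLmap-congAll (allChains-head r q m) (λ N N₀≡m → ≈-trans (chainTerm-∷ᶜ n N)
               (reflexive (cong₂ (λ E V → E * (weight t₀ (Σℕ n) V * chainTerm x′ t′ N))
                                 (expProd-≗ x₀ (d≗ {N = N} N₀≡m)) (Σℕ-≗ (d≗ {N = N} N₀≡m))))) ⟩
        ΣLmap (λ N → expProd x₀ (n ∸ᵥ m) * (weight t₀ (Σℕ n) (Σℕ (n ∸ᵥ m)) * chainTerm x′ t′ N)) (allChains r q m)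
          ≈⟨ ΣLmap-distribˡ _ _ (allChains r q m) ⟩
        expProd x₀ (n ∸ᵥ m) * ΣLmap (λ N → weight t₀ (Σℕ n) (Σℕ (n ∸ᵥ m)) * chainTerm x′ t′ N) (allChains r q m)
          ≈⟨ *-congˡ (ΣLmap-distribˡ _ _ (allChains r q m)) ⟩
        expProd x₀ (n ∸ᵥ m) * (weight t₀ (Σℕ n) (Σℕ (n ∸ᵥ m)) * ordCoeff x′ t′ m) ∎

    Φ : ℕ → ℕ → (Fin r → ℕ) → Carrier
    Φ N v m = weight t₀ N v * ordCoeff x′ t′ m

    shiftedSum : (Fin r → ℕ) → Carrier
    shiftedSum n = ΣBox n (λ m → ι (Σℕ (n ∸ᵥ m)) * (expProd x₀ (n ∸ᵥ m) * Φ (pred (Σℕ n)) (pred (Σℕ (n ∸ᵥ m))) m))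

    scaled-ordCoeff : ∀ n → (ι (Σℕ n) + t₀) * ordCoeff x t n ≈ shiftedSum n + ordCoeff x′ t′ n
    scaled-ordCoeff n = begin
      (ι (Σℕ n) + t₀) * ordCoeff x t n
        ≈⟨ *-congˡ (ordCoeff-peel n) ⟩
      (ι (Σℕ n) + t₀) * ΣBox n (λ m → expProd x₀ (n ∸ᵥ m) * Φ (Σℕ n) (Σℕ (n ∸ᵥ m)) m)
        ≈⟨ ΣBox-distribˡ n _ _ ⟨
      ΣBox n (λ m → (ι (Σℕ n) + t₀) * (expProd x₀ (n ∸ᵥ m) * Φ (Σℕ n) (Σℕ (n ∸ᵥ m)) m))
        ≈⟨ ΣBox-cong n (λ m → *-weight-recurrence (t+k≉0 zero) (Σℕ n) (Σℕ (n ∸ᵥ m)) _ _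
                                (Σℕ-mono-≤ λ i → ℕₚ.m∸n≤m (n i) (m i)) (expProd-zero x₀ (n ∸ᵥ m))) ⟩
      ΣBox n (λ m → ι (Σℕ (n ∸ᵥ m)) * (expProd x₀ (n ∸ᵥ m) * Φ (pred (Σℕ n)) (pred (Σℕ (n ∸ᵥ m))) m)
                    + δ₀ (Σℕ (n ∸ᵥ m)) * ordCoeff x′ t′ m)
        ≈⟨ ΣBox-+ n _ _ ⟩
      shiftedSum n + ΣBox n (λ m → δ₀ (Σℕ (n ∸ᵥ m)) * ordCoeff x′ t′ m)
        ≈⟨ +-congˡ (ΣBox-δ₀ n (ordCoeff x′ t′) (reflexive ∘ ordCoeff-≗ x′ t′)) ⟩
      shiftedSum n + ordCoeff x′ t′ n ∎

    shifted-ordCoeff : ∀ n → ΣF (λ i → x₀ i * mulX i (ordCoeff x t) n) ≈ shiftedSum n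
    shifted-ordCoeff n = begin
      ΣF (λ i → x₀ i * mulX i (ordCoeff x t) n)
        ≈⟨ ΣF-cong (λ i → *-congˡ (≈-trans (reflexive (mulX-whenSuc i (ordCoeff x t) n)) (peelBelow i (n i) refl))) ⟩
      ΣF (λ i → x₀ i * whenSuc (n i) (expConv x₀ (Φ (pred (Σℕ n))) (updateAt n i pred)))
        ≈⟨ ΣF-cong (expConv-shift x₀ (Φ (pred (Σℕ n))) n) ⟩
      ΣF (λ i → ΣBox n (λ m → ι (n i ∸ m i) * Z m))
        ≈⟨ ΣBox-ΣF n (λ i m → ι (n i ∸ m i) * Z m) ⟩
      ΣBox n (λ m → ΣF (λ i → ι (n i ∸ m i) * Z m))
        ≈⟨ ΣBox-cong n (λ m → ≈-trans (ΣF-distribʳ (Z m) (ι ∘ (n ∸ᵥ m))) (*-congʳ (≈-sym (ι-Σℕ (n ∸ᵥ m))))) ⟩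
      shiftedSum n ∎
      where
      Z : (Fin r → ℕ) → Carrier
      Z m = expProd x₀ (n ∸ᵥ m) * Φ (pred (Σℕ n)) (pred (Σℕ (n ∸ᵥ m))) m
      peelBelow : ∀ i k → n i ≡ k → whenSuc k (ordCoeff x t (updateAt n i pred))
                                    ≈ whenSuc k (expConv x₀ (Φ (pred (Σℕ n))) (updateAt n i pred))
      peelBelow i zero    _      = ≈-refl
      peelBelow i (suc k) nᵢ≡1+k = ≈-trans (ordCoeff-peel (updateAt n i pred))
        (reflexive (cong (λ N → expConv x₀ (Φ N) (updateAt n i pred)) (cong pred (Σℕ-updateAt-pred n i nᵢ≡1+k))))

proposition3p5 : ∀ {c ℓ} (F : Field c ℓ) → CharZero F →
    let open Coefficients F
    in (r q : ℕ) → 1 ≤ r →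
    (x : Fin r → Fin (suc (suc q)) → Carrier) →
    (t : Fin (suc q) → Carrier) →
    (∀ j (k : ℕ) → ¬ (t j + ι k ≈ 0#)) →
    ξ+ (λ i → x i zero) (t zero) (genFun x t)
    ≋ genFun (λ i → x i ∘ suc) (t ∘ suc)
proposition3p5 F char0 r q _ x t t+k≉0 n = begin
  ξ+ x₀ t₀ (genFun x t) n
    ≈⟨ ξ+-cong x₀ t₀ (genFun≈ordCoeff x t) n ⟩
  ξ+ x₀ t₀ (ordCoeff x t) n
    ≈⟨ ξ+-expand x₀ t₀ (ordCoeff x t) n ⟩
  (ι (Σℕ n) + t₀) * ordCoeff x t n - ΣF (λ i → x₀ i * mulX i (ordCoeff x t) n)
    ≈⟨ +-cong (scaled-ordCoeff n) (-‿cong (shifted-ordCoeff n)) ⟩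
  shiftedSum n + ordCoeff x′ t′ n - shiftedSum n
    ≈⟨ xyx⁻¹≈y (shiftedSum n) (ordCoeff x′ t′ n) ⟩
  ordCoeff x′ t′ n
    ≈⟨ genFun≈ordCoeff x′ t′ n ⟨
  genFun x′ t′ n ∎
  where
  open Field F hiding (zero)
  open FieldOps F
  open Coefficients F using (genFun; mulX; ξ+)
  open FieldProperties F
  open ChainCoefficients F char0
  open ColumnRecursion x t t+k≉0
  open import Relation.Binary.Reasoning.Setoid setoid
  open import Algebra.Properties.AbelianGroup +-abelianGroup using (xyx⁻¹≈y)
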